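{- Let $n\ge2$ and $m\ge2$, and let $S$ be a set of representatives of the isomorphism classes of $\mathrm{Bi}(m-1,n)$. For each $T\in S$ let $R_T$ be a set of representatives of the equivalence classes of $V_e(T)$ under the relation $v\sim w$ iff $\sigma(v)=w$ for some $\sigma\in\operatorname{Aut}_e(T)$. Then every element of $\mathrm{Bi}(m,n)$ is isomorphic to $\operatorname{Ext}(T,v)$ for some $T\in S$ and $v\in R_T$; hence removing isomorphic duplicates from $\{\operatorname{Ext}(T,v): T\in S,\ v\in R_T\}$ yields a set of representatives of the isomorphism classes of $\mathrm{Bi}(m,n)$ (and $\mathrm{Bi}(1,n)$ consists of the star with one vertex of valence $n$ and $n$ leaves).
   Context: $\mathrm{Bi}(m,n)$ denotes the set of finite trees all of whose vertices have valence $1$ or $n$ and which have exactly $m$ vertices of valence $n$. $V_e(T)$ is the set of external vertices (valence $1$) of $T$; internal vertices are those of valence $>1$ and $T_i$ is the subtree on the internal vertices (edges of $T$ between internal vertices). $\operatorname{Aut}_e(T)$ is the kernel of the restriction homomorphism $\operatorname{Aut}(T)\to\operatorname{Aut}(T_i)$. For $v\in V_e(T)$, $\operatorname{Ext}(T,v)$ is the tree obtained from $T$ by adding $n-1$ new vertices and $n-1$ new edges joining $v$ with each of them. -}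

module Defs where

open import Data.Nat using (ℕ; zero; suc; _+_; _∸_; _<_) renaming (_≟_ to _ℕ≟_)
open import Data.Bool using (Bool; true; false; if_then_else_; _∧_)
open import Data.Fin using (Fin; zero; suc; inject₁; fromℕ; splitAt; _≟_)
open import Data.List using (List; map; allFin)
open import Data.Nat.ListAction using (sum)
open import Data.List.Membership.Propositional using (_∈_)
open import Data.Sum using (_⊎_; inj₁; inj₂)
open import Data.Product using (Σ; _×_; _,_; ∃)
open import Relation.Nullary using (¬_)
open import Relation.Nullary.Decidable using (⌊_⌋)
open import Relation.Binary.PropositionalEquality using (_≡_)
open import Function.Bundles using (_↔_; Inverse)

record Graph : Set where
  constructor mkGraph
  field
    size : ℕ
    adj  : Fin size → Fin size → Bool
open Graph public

data Walk (G : Graph) : Fin (size G) → Fin (size G) → Set where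
  here : ∀ {u} → Walk G u u
  step : ∀ {u v w} → adj G u v ≡ true → Walk G v w → Walk G u w

IsCycle : (G : Graph) (j : ℕ) → (Fin (3 + j) → Fin (size G)) → Set
IsCycle G j c =
  (∀ a b → c a ≡ c b → a ≡ b) ×
  (∀ (i : Fin (2 + j)) → adj G (c (inject₁ i)) (c (suc i)) ≡ true) ×
  (adj G (c (fromℕ (2 + j))) (c zero) ≡ true)

record IsTree (G : Graph) : Set where
  field
    nonempty   : 0 < size G
    symmetric  : ∀ u v → adj G u v ≡ adj G v u
    loopless   : ∀ u → adj G u u ≡ false
    connected  : ∀ u v → Walk G u v
    acyclic    : ∀ j (c : Fin (3 + j) → Fin (size G)) → ¬ IsCycle G j c

countᵇ : {A : Set} → (A → Bool) → List A → ℕ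
countᵇ p xs = sum (map (λ x → if p x then 1 else 0) xs)

valence : (G : Graph) → Fin (size G) → ℕ
valence G v = countᵇ (adj G v) (allFin (size G))

IsExternal : (G : Graph) → Fin (size G) → Set
IsExternal G v = valence G v ≡ 1

IsInternal : (G : Graph) → Fin (size G) → Set
IsInternal G v = 1 < valence G v

record Bi (m n : ℕ) (G : Graph) : Set where
  field
    tree     : IsTree G
    valences : ∀ v → valence G v ≡ 1 ⊎ valence G v ≡ n
    count-n  : countᵇ (λ v → ⌊ valence G v ℕ≟ n ⌋) (allFin (size G)) ≡ m

record _≅_ (G H : Graph) : Set where
  field
    bij      : Fin (size G) ↔ Fin (size H)
    preserve : ∀ u v → adj H (Inverse.to bij u) (Inverse.to bij v) ≡ adj G u v
open _≅_ public

isoMap : ∀ {G H} → G ≅ H → Fin (size G) → Fin (size H)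
isoMap σ = Inverse.to (bij σ)

IsAutₑ : (T : Graph) → T ≅ T → Set
IsAutₑ T σ = ∀ v → IsInternal T v → isoMap σ v ≡ v

ExtEquiv : (T : Graph) → Fin (size T) → Fin (size T) → Set
ExtEquiv T v w = Σ (T ≅ T) λ σ → IsAutₑ T σ × isoMap σ v ≡ w

Ext : (n : ℕ) (T : Graph) → Fin (size T) → Graph
Ext n T v = mkGraph (size T + (n ∸ 1)) a
  where
  a : Fin (size T + (n ∸ 1)) → Fin (size T + (n ∸ 1)) → Bool
  a x y with splitAt (size T) x | splitAt (size T) y
  ... | inj₁ x' | inj₁ y' = adj T x' y'
  ... | inj₁ x' | inj₂ _  = ⌊ x' ≟ v ⌋
  ... | inj₂ _  | inj₁ y' = ⌊ y' ≟ v ⌋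
  ... | inj₂ _  | inj₂ _  = false

star : ℕ → Graph
star n = mkGraph (suc n) a
  where
  a : Fin (suc n) → Fin (suc n) → Bool
  a zero    (suc _) = true
  a (suc _) zero    = true
  a _       _       = false

{-# OPTIONS --safe #-}
-- Ext(T, v) at a leaf v of T ∈ Bi(m−1, n) makes v a vertex of valence n and adds n−1 leaves,
-- so it lies in Bi(m, n). Conversely, for T ∈ Bi(m, n) with m ≥ 2 the internal vertices span
-- a tree T_i with at least two vertices; extending a path of T_i as far as possible ends at a
-- leaf u of T_i. In T, u carries n−1 leaves; deleting them gives T₀ ∈ Bi(m−1, n) in which u is
-- a leaf, and T ≅ Ext(T₀, u). Since Ext respects isomorphisms of pointed trees, T₀ may be
-- replaced by its representative S_i and u by the representative in R_i of its Aut_e-orbit.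
-- A tree in Bi(1, n) has a single internal vertex, adjacent to all n others: it is the star.
module Submission where

open import Defs
open import Data.Nat using (ℕ; zero; suc; _+_; _∸_; _≤_; _<_; z≤n; s≤s; s≤s⁻¹) renaming (_≟_ to _ℕ≟_)
open import Data.Nat.Properties hiding (_≟_)
open import Data.Bool using (Bool; true; false; if_then_else_; _∧_; _xor_)
open import Data.Bool.Properties using (¬-not; ∧-conicalˡ; ∧-conicalʳ; ∧-zeroʳ) renaming (_≟_ to _Bool≟_)
open import Data.Fin
  using (Fin; zero; suc; toℕ; fromℕ; inject₁; inject≤; _↑ˡ_; _↑ʳ_; splitAt; join; punchIn; punchOut; _≟_)
open import Data.Fin.Properties
  using ( any?; +↔⊎; toℕ-inject₁; toℕ-inject≤; toℕ-fromℕ; toℕ<n; toℕ-injective; inject≤-injective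
        ; injective⇒≤; splitAt-↑ˡ; splitAt-↑ʳ; splitAt-join; join-splitAt; punchInᵢ≢i; punchIn-punchOut)
open import Data.List using (List; allFin; tabulate)
open import Data.Vec.Functional using (_∷_; [])
import Data.Nat.ListAction as List
open import Data.List.Properties using (map-tabulate)
open import Data.List.Membership.Propositional using (_∈_)
open import Data.Sum using (_⊎_; inj₁; inj₂) renaming (map to ⊎-map)
open import Data.Sum.Properties using (inj₁-injective)
open import Data.Product using (Σ; ∃; ∃₂; _×_; _,_; proj₁; proj₂)
open import Data.Empty using (⊥)
open import Relation.Nullary using (¬_; Dec; yes; no; contradiction)
open import Relation.Nullary.Decidable using (⌊_⌋; dec-true; ¬?; _×-dec_)
open import Relation.Binary.PropositionalEquality
open import Function using (_∘_; id; _↔_; Inverse; Injection; mk↔ₛ′)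
open import Function.Construct.Composition using (_↔-∘_)
open import Function.Properties.Inverse using (↔⇒↣; ↔-refl; ↔-sym)
open import Data.Sum.Function.Propositional using (_⊎-↔_)
open import Data.Fin.Permutation using (transpose)
open import Algebra.Properties.CommutativeMonoid.Sum +-0-commutativeMonoid
  using (sum; sum-cong-≗; sum-remove; sum-permute; sum-replicate-zero)

⌊⌋-true : ∀ {A : Set} (a? : Dec A) → A → ⌊ a? ⌋ ≡ true
⌊⌋-true (yes _) _ = refl
⌊⌋-true (no ¬a) a = contradiction a ¬a

⌊⌋-false : ∀ {A : Set} (a? : Dec A) → ¬ A → ⌊ a? ⌋ ≡ false
⌊⌋-false (yes a) ¬a = contradiction a ¬a
⌊⌋-false (no _)  _  = refl

⌊⌋-⇔ : ∀ {A B : Set} (a? : Dec A) (b? : Dec B) → (A → B) → (B → A) → ⌊ a? ⌋ ≡ ⌊ b? ⌋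
⌊⌋-⇔ (yes a) b? a→b b→a = sym (⌊⌋-true b? (a→b a))
⌊⌋-⇔ (no ¬a) b? a→b b→a = sym (⌊⌋-false b? (¬a ∘ b→a))

⌊⌋≡true⇒ : ∀ {A : Set} (a? : Dec A) → ⌊ a? ⌋ ≡ true → A
⌊⌋≡true⇒ (yes a) _ = a

𝟙 : Bool → ℕ
𝟙 b = if b then 1 else 0

count : ∀ {N} → (Fin N → Bool) → ℕ
count p = sum (𝟙 ∘ p)

listSum-tabulate : ∀ {N} (f : Fin N → ℕ) → List.sum (tabulate f) ≡ sum f
listSum-tabulate {zero}  f = refl
listSum-tabulate {suc N} f = cong (f zero +_) (listSum-tabulate (f ∘ suc))

countᵇ-allFin : ∀ {N} (p : Fin N → Bool) → countᵇ p (allFin N) ≡ count p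
countᵇ-allFin p = trans (cong List.sum (map-tabulate id (𝟙 ∘ p))) (listSum-tabulate (𝟙 ∘ p))

sum-zero : ∀ {N} (f : Fin N → ℕ) → (∀ x → f x ≡ 0) → sum f ≡ 0
sum-zero {N} f f≡0 = trans (sum-cong-≗ f≡0) (sum-replicate-zero N)

sum-one : ∀ N → sum {N} (λ _ → 1) ≡ N
sum-one zero    = refl
sum-one (suc N) = cong suc (sum-one N)

sum-↑ : ∀ A {K} (f : Fin (A + K) → ℕ) → sum f ≡ sum (f ∘ (_↑ˡ K)) + sum (f ∘ (A ↑ʳ_))
sum-↑ zero    f = refl
sum-↑ (suc A) f = trans (cong (f zero +_) (sum-↑ A (f ∘ suc))) (sym (+-assoc (f zero) _ _))

-- Removing the x-th term leaves the sum over the punched-in indices, which avoid x.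
sum-update : ∀ {N} (f g : Fin N → ℕ) x → (∀ y → y ≢ x → f y ≡ g y) → sum f + g x ≡ sum g + f x
sum-update {suc N} f g x f≗g = begin
  sum f + g x                            ≡⟨ cong (_+ g x) (sum-remove {i = x} f) ⟩
  f x + sum (f ∘ punchIn x) + g x        ≡⟨ cong (λ s → f x + s + g x) (sum-cong-≗ off-x) ⟩
  f x + sum (g ∘ punchIn x) + g x        ≡⟨ +-comm (f x + _) (g x) ⟩
  g x + (f x + sum (g ∘ punchIn x))      ≡⟨ cong (g x +_) (+-comm (f x) _) ⟩
  g x + (sum (g ∘ punchIn x) + f x)      ≡⟨ +-assoc (g x) _ (f x) ⟨
  g x + sum (g ∘ punchIn x) + f x        ≡⟨ cong (_+ f x) (sum-remove {i = x} g) ⟨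
  sum g + f x                            ∎
  where
  open ≡-Reasoning
  off-x : ∀ y → f (punchIn x y) ≡ g (punchIn x y)
  off-x y = f≗g (punchIn x y) (punchInᵢ≢i x y)

count-single : ∀ {N} (p : Fin N → Bool) x → p x ≡ true → (∀ y → y ≢ x → p y ≡ false) → count p ≡ 1
count-single {N} p x px others = begin
  count p                     ≡⟨ +-identityʳ (count p) ⟨
  count p + 0                 ≡⟨ sum-update (𝟙 ∘ p) (λ _ → 0) x (λ y y≢x → cong 𝟙 (others y y≢x)) ⟩
  sum {N} (λ _ → 0) + 𝟙 (p x) ≡⟨ cong₂ _+_ (sum-zero {N} _ (λ _ → refl)) (cong 𝟙 px) ⟩
  1                           ∎
  where open ≡-Reasoning

count-true : ∀ {N} (p : Fin (suc N) → Bool) x → p x ≡ true → count p ≡ suc (count (p ∘ punchIn x))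
count-true p x px = trans (sum-remove {i = x} (𝟙 ∘ p)) (cong (λ b → 𝟙 b + count (p ∘ punchIn x)) px)

count-witness : ∀ {N} (p : Fin N → Bool) → 0 < count p → ∃ λ x → p x ≡ true
count-witness {suc N} p pos with p zero in p0
... | true  = zero , p0
... | false = let x , px = count-witness (p ∘ suc) pos in suc x , px

count-pos : ∀ {N} (p : Fin N → Bool) x → p x ≡ true → 0 < count p
count-pos {suc N} p x px = subst (0 <_) (sym (count-true p x px)) (s≤s z≤n)

count-unique : ∀ {N} (p : Fin N → Bool) → count p ≡ 1 → ∀ {x y} → p x ≡ true → p y ≡ true → x ≡ y
count-unique {suc N} p one {x} {y} px py with x ≟ y
... | yes x≡y = x≡y
... | no x≢y = contradiction (subst (0 <_) rest≡0 rest-pos) (λ ())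
  where
  rest≡0 : count (p ∘ punchIn x) ≡ 0
  rest≡0 = suc-injective (trans (sym (count-true p x px)) one)
  rest-pos : 0 < count (p ∘ punchIn x)
  rest-pos = count-pos (p ∘ punchIn x) (punchOut x≢y) (trans (cong p (punchIn-punchOut x≢y)) py)

count-two : ∀ {N} (p : Fin N → Bool) → 2 ≤ count p → ∃₂ λ x y → x ≢ y × p x ≡ true × p y ≡ true
count-two {suc N} p two =
  let x , px = count-witness p (≤-trans (s≤s z≤n) two)
      y , py = count-witness (p ∘ punchIn x) (s≤s⁻¹ (subst (2 ≤_) (count-true p x px) two))
  in x , punchIn x y , (λ x≡y → punchInᵢ≢i x y (sym x≡y)) , px , py

≅-trans : ∀ {G H K} → G ≅ H → H ≅ K → G ≅ K
≅-trans φ ψ = record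
  { bij      = bij ψ ↔-∘ bij φ
  ; preserve = λ x y → trans (preserve ψ _ _) (preserve φ x y) }

isoMap-injective : ∀ {G H} (φ : G ≅ H) {x y} → isoMap φ x ≡ isoMap φ y → x ≡ y
isoMap-injective φ = Injection.injective (↔⇒↣ (bij φ))

valence≡count : ∀ G x → valence G x ≡ count (adj G x)
valence≡count G x = countᵇ-allFin (adj G x)

valence-isoMap : ∀ {G H} (φ : G ≅ H) x → valence H (isoMap φ x) ≡ valence G x
valence-isoMap {G} {H} φ x = begin
  valence H (isoMap φ x)                      ≡⟨ valence≡count H (isoMap φ x) ⟩
  count (adj H (isoMap φ x))                  ≡⟨ sum-permute (𝟙 ∘ adj H (isoMap φ x)) (bij φ) ⟩
  count (adj H (isoMap φ x) ∘ isoMap φ)       ≡⟨ sum-cong-≗ (cong 𝟙 ∘ preserve φ x) ⟩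
  count (adj G x)                             ≡⟨ valence≡count G x ⟨
  valence G x                                 ∎
  where open ≡-Reasoning

leaf-neighbour-unique : ∀ G {x y z} → valence G x ≡ 1 → adj G x y ≡ true → adj G x z ≡ true → y ≡ z
leaf-neighbour-unique G {x} leaf = count-unique (adj G x) (trans (sym (valence≡count G x)) leaf)

_◅◅_ : ∀ {G x y z} → Walk G x y → Walk G y z → Walk G x z
here     ◅◅ w′ = w′
step e w ◅◅ w′ = step e (w ◅◅ w′)

Walk-map : ∀ {G H} (f : Fin (size G) → Fin (size H)) →
  (∀ {x y} → adj G x y ≡ true → adj H (f x) (f y) ≡ true) → ∀ {x y} → Walk G x y → Walk H (f x) (f y)
Walk-map f f-adj here       = here
Walk-map f f-adj (step e w) = step (f-adj e) (Walk-map f f-adj w)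

AtMostOneNeighbour : (G : Graph) → Fin (size G) → Set
AtMostOneNeighbour G x = ∀ {y z} → adj G x y ≡ true → adj G x z ≡ true → y ≡ z

last-or-inject₁ : ∀ {k} (s : Fin (suc k)) → s ≡ fromℕ k ⊎ ∃ λ r → s ≡ inject₁ r
last-or-inject₁ {zero}  zero    = inj₁ refl
last-or-inject₁ {suc k} zero    = inj₂ (zero , refl)
last-or-inject₁ {suc k} (suc s) with last-or-inject₁ s
... | inj₁ s≡last      = inj₁ (cong suc s≡last)
... | inj₂ (r , s≡r)   = inj₂ (suc r , cong suc s≡r)

-- Each vertex of a cycle has its two cycle-neighbours, which are distinct.
cycle-avoids-pendant : ∀ G j c → (∀ u v → adj G u v ≡ adj G v u) → IsCycle G j c →
  ∀ t → ¬ AtMostOneNeighbour G (c t)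
cycle-avoids-pendant G j c sym-adj (c-inj , path , close) zero pendant
  with c-inj _ _ (pendant (path zero) (trans (sym-adj _ _) close))
... | ()
cycle-avoids-pendant G j c sym-adj (c-inj , path , close) (suc s) pendant with last-or-inject₁ s
... | inj₁ refl with c-inj _ _ (pendant (trans (sym-adj _ _) (path s)) close)
...   | ()
cycle-avoids-pendant G j c sym-adj (c-inj , path , close) (suc s) pendant | inj₂ (r , refl)
  with cong toℕ (c-inj _ _ (pendant (trans (sym-adj _ _) (path s)) (path (suc r))))
... | r≡2+r rewrite toℕ-inject₁ (inject₁ r) | toℕ-inject₁ r = m≢1+n+m (toℕ r) {1} r≡2+r

-- The extension Ext(T, v)

module _ (n : ℕ) (T : Graph) (v : Fin (size T)) where

  Ext-adj : Fin (size T) ⊎ Fin (n ∸ 1) → Fin (size T) ⊎ Fin (n ∸ 1) → Bool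
  Ext-adj (inj₁ x) (inj₁ y) = adj T x y
  Ext-adj (inj₁ x) (inj₂ _) = ⌊ x ≟ v ⌋
  Ext-adj (inj₂ _) (inj₁ y) = ⌊ y ≟ v ⌋
  Ext-adj (inj₂ _) (inj₂ _) = false

  adj-Ext : ∀ x y → adj (Ext n T v) x y ≡ Ext-adj (splitAt (size T) x) (splitAt (size T) y)
  adj-Ext x y with splitAt (size T) x | splitAt (size T) y
  ... | inj₁ _ | inj₁ _ = refl
  ... | inj₁ _ | inj₂ _ = refl
  ... | inj₂ _ | inj₁ _ = refl
  ... | inj₂ _ | inj₂ _ = refl

  ≅-Ext : ∀ {G} (ψ : Fin (size G) ↔ (Fin (size T) ⊎ Fin (n ∸ 1))) →
    (∀ x y → Ext-adj (Inverse.to ψ x) (Inverse.to ψ y) ≡ adj G x y) → G ≅ Ext n T v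
  ≅-Ext {G} ψ ψ-adj = record
    { bij      = ↔-sym +↔⊎ ↔-∘ ψ
    ; preserve = λ x y → trans (adj-Ext _ _)
        (trans (cong₂ Ext-adj (splitAt-join _ _ (to x)) (splitAt-join _ _ (to y))) (ψ-adj x y)) }
    where
    to : Fin (size G) → Fin (size T) ⊎ Fin (n ∸ 1)
    to = Inverse.to ψ

Ext-cong : ∀ n {A B} (φ : A ≅ B) {a b} → isoMap φ a ≡ b → Ext n A a ≅ Ext n B b
Ext-cong n {A} {B} φ {a} {b} φa≡b = ≅-Ext n B b ((bij φ ⊎-↔ ↔-refl) ↔-∘ +↔⊎)
  (λ x y → trans (map-adj (splitAt (size A) x) (splitAt (size A) y)) (sym (adj-Ext n A a x y)))
  where
  ⌊≟⌋-isoMap : ∀ x → ⌊ isoMap φ x ≟ b ⌋ ≡ ⌊ x ≟ a ⌋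
  ⌊≟⌋-isoMap x = ⌊⌋-⇔ (isoMap φ x ≟ b) (x ≟ a)
    (λ φx≡b → isoMap-injective φ (trans φx≡b (sym φa≡b))) (λ { refl → φa≡b })
  map-adj : ∀ s t → Ext-adj n B b (⊎-map (isoMap φ) id s) (⊎-map (isoMap φ) id t) ≡ Ext-adj n A a s t
  map-adj (inj₁ x) (inj₁ y) = preserve φ x y
  map-adj (inj₁ x) (inj₂ _) = ⌊≟⌋-isoMap x
  map-adj (inj₂ _) (inj₁ y) = ⌊≟⌋-isoMap y
  map-adj (inj₂ _) (inj₂ _) = refl

module ExtVertices (n : ℕ) (T : Graph) (v : Fin (size T)) where
  private
    N K : ℕ
    N = size T
    K = n ∸ 1
    E : Graph
    E = Ext n T v

  old : Fin N → Fin (N + K)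
  old a = a ↑ˡ K

  new : Fin K → Fin (N + K)
  new k = N ↑ʳ k

  adj-old-old : ∀ a b → adj E (old a) (old b) ≡ adj T a b
  adj-old-old a b = trans (adj-Ext n T v _ _) (cong₂ (Ext-adj n T v) (splitAt-↑ˡ N a K) (splitAt-↑ˡ N b K))

  adj-old-new : ∀ a k → adj E (old a) (new k) ≡ ⌊ a ≟ v ⌋
  adj-old-new a k = trans (adj-Ext n T v _ _) (cong₂ (Ext-adj n T v) (splitAt-↑ˡ N a K) (splitAt-↑ʳ N K k))

  adj-new-old : ∀ k b → adj E (new k) (old b) ≡ ⌊ b ≟ v ⌋
  adj-new-old k b = trans (adj-Ext n T v _ _) (cong₂ (Ext-adj n T v) (splitAt-↑ʳ N K k) (splitAt-↑ˡ N b K))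

  adj-new-new : ∀ k l → adj E (new k) (new l) ≡ false
  adj-new-new k l = trans (adj-Ext n T v _ _) (cong₂ (Ext-adj n T v) (splitAt-↑ʳ N K k) (splitAt-↑ʳ N K l))

  old-or-new : ∀ x → (∃ λ a → x ≡ old a) ⊎ (∃ λ k → x ≡ new k)
  old-or-new x with splitAt N x in eq
  ... | inj₁ a = inj₁ (a , trans (sym (join-splitAt N K x)) (cong (join N K) eq))
  ... | inj₂ k = inj₂ (k , trans (sym (join-splitAt N K x)) (cong (join N K) eq))

  old≢new : ∀ a k → old a ≢ new k
  old≢new a k eq with trans (sym (splitAt-↑ˡ N a K)) (trans (cong (splitAt N) eq) (splitAt-↑ʳ N K k))
  ... | ()

  new-neighbour : ∀ k {y} → adj E (new k) y ≡ true → y ≡ old v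
  new-neighbour k {y} e with old-or-new y
  ... | inj₁ (b , refl) = cong old (⌊⌋≡true⇒ (b ≟ v) (trans (sym (adj-new-old k b)) e))
  ... | inj₂ (l , refl) = contradiction (trans (sym e) (adj-new-new k l)) (λ ())

  new-pendant : ∀ k → AtMostOneNeighbour E (new k)
  new-pendant k ey ez = trans (new-neighbour k ey) (sym (new-neighbour k ez))

  count-old-new : (p : Fin (N + K) → Bool) → count p ≡ count (p ∘ old) + count (p ∘ new)
  count-old-new p = sum-↑ N (𝟙 ∘ p)

  valence-old : ∀ a → valence E (old a) ≡ valence T a + count {K} (λ _ → ⌊ a ≟ v ⌋)
  valence-old a = begin
    valence E (old a)                                   ≡⟨ valence≡count E (old a) ⟩
    count (adj E (old a))                               ≡⟨ count-old-new (adj E (old a)) ⟩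
    count (adj E (old a) ∘ old) + count (adj E (old a) ∘ new)
      ≡⟨ cong₂ _+_ (sum-cong-≗ (cong 𝟙 ∘ adj-old-old a)) (sum-cong-≗ (cong 𝟙 ∘ adj-old-new a)) ⟩
    count (adj T a) + count {K} (λ _ → ⌊ a ≟ v ⌋)
      ≡⟨ cong (_+ count {K} (λ _ → ⌊ a ≟ v ⌋)) (valence≡count T a) ⟨
    valence T a + count {K} (λ _ → ⌊ a ≟ v ⌋)           ∎
    where open ≡-Reasoning

  valence-old-v : valence E (old v) ≡ valence T v + K
  valence-old-v = trans (valence-old v)
    (cong (valence T v +_) (trans (sum-cong-≗ {K} (λ _ → cong 𝟙 (⌊⌋-true (v ≟ v) refl))) (sum-one K)))

  valence-old-≢ : ∀ {a} → a ≢ v → valence E (old a) ≡ valence T a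
  valence-old-≢ {a} a≢v = trans (valence-old a)
    (trans (cong (valence T a +_) (sum-zero {K} _ (λ _ → cong 𝟙 (⌊⌋-false (a ≟ v) a≢v)))) (+-identityʳ _))

  valence-new : ∀ k → valence E (new k) ≡ 1
  valence-new k = begin
    valence E (new k)                                   ≡⟨ valence≡count E (new k) ⟩
    count (adj E (new k))                               ≡⟨ count-old-new (adj E (new k)) ⟩
    count (adj E (new k) ∘ old) + count (adj E (new k) ∘ new)
      ≡⟨ cong₂ _+_ (count-single _ v (trans (adj-new-old k v) (⌊⌋-true (v ≟ v) refl))
                     (λ b b≢v → trans (adj-new-old k b) (⌊⌋-false (b ≟ v) b≢v)))
                   (sum-zero _ (cong 𝟙 ∘ adj-new-new k)) ⟩
    1                                                   ∎
    where open ≡-Reasoning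

Ext-adj-symmetric : ∀ n T v → (∀ a b → adj T a b ≡ adj T b a) → ∀ s t → Ext-adj n T v s t ≡ Ext-adj n T v t s
Ext-adj-symmetric n T v sym-adj (inj₁ a) (inj₁ b) = sym-adj a b
Ext-adj-symmetric n T v sym-adj (inj₁ a) (inj₂ _) = refl
Ext-adj-symmetric n T v sym-adj (inj₂ _) (inj₁ b) = refl
Ext-adj-symmetric n T v sym-adj (inj₂ _) (inj₂ _) = refl

Ext-adj-loopless : ∀ n T v → (∀ a → adj T a a ≡ false) → ∀ s → Ext-adj n T v s s ≡ false
Ext-adj-loopless n T v loopless (inj₁ a) = loopless a
Ext-adj-loopless n T v loopless (inj₂ _) = refl

Ext-isTree : ∀ n T v → IsTree T → IsTree (Ext n T v)
Ext-isTree n T v tree = record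
  { nonempty  = ≤-trans nonempty (m≤m+n (size T) (n ∸ 1))
  ; symmetric = symmetricᴱ
  ; loopless  = λ x → trans (adj-Ext n T v x x) (Ext-adj-loopless n T v loopless (splitAt (size T) x))
  ; connected = λ x y → to-v x ◅◅ from-v y
  ; acyclic   = acyclicᴱ }
  where
  open IsTree tree
  open ExtVertices n T v
  E : Graph
  E = Ext n T v

  symmetricᴱ : ∀ x y → adj E x y ≡ adj E y x
  symmetricᴱ x y = trans (adj-Ext n T v x y)
    (trans (Ext-adj-symmetric n T v symmetric (splitAt (size T) x) (splitAt (size T) y)) (sym (adj-Ext n T v y x)))

  lift : ∀ {a b} → Walk T a b → Walk E (old a) (old b)
  lift = Walk-map old (λ {a} {b} e → trans (adj-old-old a b) e)

  v-new : ∀ k → adj E (old v) (new k) ≡ true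
  v-new k = trans (adj-old-new v k) (⌊⌋-true (v ≟ v) refl)

  to-v : ∀ x → Walk E x (old v)
  to-v x with old-or-new x
  ... | inj₁ (a , refl) = lift (connected a v)
  ... | inj₂ (k , refl) = step (trans (symmetricᴱ (new k) (old v)) (v-new k)) here

  from-v : ∀ x → Walk E (old v) x
  from-v x with old-or-new x
  ... | inj₁ (a , refl) = lift (connected v a)
  ... | inj₂ (k , refl) = step (v-new k) here

  new? : ∀ x → Dec (∃ λ k → x ≡ new k)
  new? x with old-or-new x
  ... | inj₁ (a , refl) = no λ (k , eq) → old≢new a k eq
  ... | inj₂ x-new      = yes x-new

  -- A cycle avoiding the new (pendant) vertices is the image of a cycle of T.
  acyclicᴱ : ∀ j c → ¬ IsCycle E j c
  acyclicᴱ j c cyc@(c-inj , path , close) with any? (λ t → new? (c t))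
  ... | yes (t , k , ct≡new) =
    cycle-avoids-pendant E j c symmetricᴱ cyc t (subst (AtMostOneNeighbour E) (sym ct≡new) (new-pendant k))
  ... | no no-new = acyclic j c′ (c′-inj , c′-path , c′-close)
    where
    preimage : ∀ t → ∃ λ a → c t ≡ old a
    preimage t with old-or-new (c t)
    ... | inj₁ c-old       = c-old
    ... | inj₂ (k , eq)    = contradiction (t , k , eq) no-new
    c′ : Fin (3 + j) → Fin (size T)
    c′ t = proj₁ (preimage t)
    c≡old : ∀ t → c t ≡ old (c′ t)
    c≡old t = proj₂ (preimage t)
    adj-c′ : ∀ s t → adj T (c′ s) (c′ t) ≡ adj E (c s) (c t)
    adj-c′ s t = trans (sym (adj-old-old _ _)) (sym (cong₂ (adj E) (c≡old s) (c≡old t)))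
    c′-inj : ∀ s t → c′ s ≡ c′ t → s ≡ t
    c′-inj s t eq = c-inj s t (trans (c≡old s) (trans (cong old eq) (sym (c≡old t))))
    c′-path : ∀ (i : Fin (2 + j)) → adj T (c′ (inject₁ i)) (c′ (suc i)) ≡ true
    c′-path i = trans (adj-c′ _ _) (path i)
    c′-close : adj T (c′ (fromℕ (2 + j))) (c′ zero) ≡ true
    c′-close = trans (adj-c′ _ _) close

ofValence : (G : Graph) → ℕ → Fin (size G) → Bool
ofValence G n x = ⌊ valence G x ℕ≟ n ⌋

Bi-count : ∀ {m n G} → Bi m n G → count (ofValence G n) ≡ m
Bi-count {n = n} {G} B = trans (sym (countᵇ-allFin (ofValence G n))) (Bi.count-n B)

ofValence-cong : ∀ {n} G H {x y} → valence G x ≡ valence H y → ofValence G n x ≡ ofValence H n y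
ofValence-cong {n} _ _ = cong (λ d → ⌊ d ℕ≟ n ⌋)

ofValence-leaf : ∀ {n} G {x} → 2 ≤ n → valence G x ≡ 1 → ofValence G n x ≡ false
ofValence-leaf G 2≤n leaf = ⌊⌋-false (_ ℕ≟ _) (λ eq → <⇒≢ 2≤n (trans (sym leaf) eq))

IsHub : ℕ → (G : Graph) → Fin (size G) → Set
IsHub n G x = valence G x ≡ n

hub? : ∀ {n} G x → Dec (IsHub n G x)
hub? {n} G x = valence G x ℕ≟ n

ofValence-hub : ∀ {n} G {x} → IsHub n G x → ofValence G n x ≡ true
ofValence-hub G {x} = ⌊⌋-true (hub? G x)

ofValence⇒hub : ∀ {n} G {x} → ofValence G n x ≡ true → IsHub n G x
ofValence⇒hub G {x} = ⌊⌋≡true⇒ (hub? G x)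

non-hub-leaf : ∀ {m n T} → Bi m n T → ∀ x → ¬ IsHub n T x → valence T x ≡ 1
non-hub-leaf B x ¬hub with Bi.valences B x
... | inj₁ leaf = leaf
... | inj₂ hub  = contradiction hub ¬hub

Ext-Bi : ∀ {m n T} v → 2 ≤ n → Bi m n T → valence T v ≡ 1 → Bi (suc m) n (Ext n T v)
Ext-Bi {m} {n} {T} v 2≤n B leaf = record
  { tree     = Ext-isTree n T v tree
  ; valences = valencesᴱ
  ; count-n  = trans (countᵇ-allFin (ofValence E n)) (begin
      count (ofValence E n)                                      ≡⟨ count-old-new (ofValence E n) ⟩
      count (ofValence E n ∘ old) + count (ofValence E n ∘ new)  ≡⟨ cong₂ _+_ count-old count-new ⟩
      m + 1 + 0                                                  ≡⟨ +-comm (m + 1) 0 ⟩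
      m + 1                                                      ≡⟨ +-comm m 1 ⟩
      suc m                                                      ∎) }
  where
  open ≡-Reasoning
  open Bi B
  open ExtVertices n T v
  E : Graph
  E = Ext n T v

  valence-old-v≡n : valence E (old v) ≡ n
  valence-old-v≡n = trans valence-old-v (trans (cong (_+ (n ∸ 1)) leaf) (m+[n∸m]≡n (≤-trans (s≤s z≤n) 2≤n)))

  valencesᴱ : ∀ x → valence E x ≡ 1 ⊎ valence E x ≡ n
  valencesᴱ x with old-or-new x
  ... | inj₂ (k , refl) = inj₁ (valence-new k)
  ... | inj₁ (a , refl) with a ≟ v
  ...   | yes refl = inj₂ valence-old-v≡n
  ...   | no a≢v rewrite valence-old-≢ a≢v = valences a

  -- Only v changes valence among the old vertices: from 1 to n.
  count-old : count (ofValence E n ∘ old) ≡ m + 1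
  count-old = begin
    count (ofValence E n ∘ old)                              ≡⟨ +-identityʳ _ ⟨
    count (ofValence E n ∘ old) + 0
      ≡⟨ cong (λ b → count (ofValence E n ∘ old) + 𝟙 b) (ofValence-leaf T 2≤n leaf) ⟨
    count (ofValence E n ∘ old) + 𝟙 (ofValence T n v)
      ≡⟨ sum-update (𝟙 ∘ ofValence E n ∘ old) (𝟙 ∘ ofValence T n) v (λ _ a≢v → cong 𝟙 (ofValence-cong E T (valence-old-≢ a≢v))) ⟩
    count (ofValence T n) + 𝟙 (ofValence E n (old v))
      ≡⟨ cong₂ (λ c b → c + 𝟙 b) (Bi-count B) (ofValence-hub E valence-old-v≡n) ⟩
    m + 1                                                    ∎

  count-new : count (ofValence E n ∘ new) ≡ 0
  count-new = sum-zero (𝟙 ∘ ofValence E n ∘ new) (λ k → cong 𝟙 (ofValence-leaf E 2≤n (valence-new k)))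

-- Stars

adj-star : ∀ {n} w u → adj (star n) w u ≡ ⌊ w ≟ zero ⌋ xor ⌊ u ≟ zero ⌋
adj-star zero    zero    = refl
adj-star zero    (suc u) = refl
adj-star (suc w) zero    = refl
adj-star (suc w) (suc u) = refl

≅-star : ∀ {n T} (c : Fin (size T)) → size T ≡ suc n →
  (∀ x y → adj T x y ≡ ⌊ x ≟ c ⌋ xor ⌊ y ≟ c ⌋) → T ≅ star n
≅-star {n} {mkGraph _ a} c refl adj≡ = record
  { bij      = τ
  ; preserve = λ x y → trans (adj-star (to x) (to y)) (trans (cong₂ _xor_ (τ≟0 x) (τ≟0 y)) (sym (adj≡ x y))) }
  where
  τ : Fin (suc n) ↔ Fin (suc n)
  τ = transpose c zero
  to : Fin (suc n) → Fin (suc n)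
  to = Inverse.to τ
  τc≡0 : to c ≡ zero
  τc≡0 rewrite dec-true (c ≟ c) refl = refl
  τ≟0 : ∀ x → ⌊ to x ≟ zero ⌋ ≡ ⌊ x ≟ c ⌋
  τ≟0 x = ⌊⌋-⇔ (to x ≟ zero) (x ≟ c)
    (λ τx≡0 → Injection.injective (↔⇒↣ τ) (trans τx≡0 (sym τc≡0))) (λ { refl → τc≡0 })

-- A walk x – y – z – … with y a leaf has z = x, so it can be shortened.
neighbour-in : ∀ {T} → IsTree T → {S : Fin (size T) → Set} → (∀ y → Dec (S y)) →
  (∀ y → ¬ S y → valence T y ≡ 1) → ∀ {x z} → x ≢ z → S z → ∃ λ y → S y × adj T x y ≡ true
neighbour-in {T} tree {S} S? leaf {x} {z} x≢z S-z = go (IsTree.connected tree x z)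
  where
  go : Walk T x z → ∃ λ y → S y × adj T x y ≡ true
  go here = contradiction refl x≢z
  go (step {v = y} x-y w) with S? y
  ... | yes S-y = y , S-y , x-y
  ... | no ¬S-y with w
  ...   | here = contradiction S-z ¬S-y
  ...   | step y-z w′ with leaf-neighbour-unique T (leaf y ¬S-y) y-z (trans (IsTree.symmetric tree y x) x-y)
  ...     | refl = go w′

Bi1-≅-star : ∀ {n T} → 2 ≤ n → Bi 1 n T → T ≅ star n
Bi1-≅-star {n} {T} 2≤n B = ≅-star c size≡ adj≡
  where
  open Bi B
  open IsTree tree
  hub : ∃ λ c → ofValence T n c ≡ true
  hub = count-witness (ofValence T n) (≤-reflexive (sym (Bi-count B)))
  c : Fin (size T)
  c = proj₁ hub

  leaf : ∀ x → x ≢ c → valence T x ≡ 1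
  leaf x x≢c = non-hub-leaf B x λ x-hub →
    x≢c (count-unique (ofValence T n) (Bi-count B) (ofValence-hub T x-hub) (proj₂ hub))

  hang : ∀ {x} → x ≢ c → adj T x c ≡ true
  hang x≢c with neighbour-in tree (_≟ c) leaf x≢c refl
  ... | _ , refl , x-c = x-c

  c-adj : ∀ {x} → x ≢ c → adj T c x ≡ true
  c-adj {x} x≢c = trans (symmetric c x) (hang x≢c)

  adj≡ : ∀ x y → adj T x y ≡ ⌊ x ≟ c ⌋ xor ⌊ y ≟ c ⌋
  adj≡ x y with x ≟ c | y ≟ c
  ... | yes refl | yes refl = loopless c
  ... | yes refl | no y≢c   = c-adj y≢c
  ... | no x≢c   | yes refl = hang x≢c
  ... | no x≢c   | no y≢c   = ¬-not λ x-y → y≢c (leaf-neighbour-unique T (leaf x x≢c) x-y (hang x≢c))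

  size≡ : size T ≡ suc n
  size≡ = begin
    size T                               ≡⟨ sum-one (size T) ⟨
    sum {size T} (λ _ → 1)               ≡⟨ +-identityʳ _ ⟨
    sum {size T} (λ _ → 1) + 0           ≡⟨ cong (λ b → sum {size T} (λ _ → 1) + 𝟙 b) (loopless c) ⟨
    sum {size T} (λ _ → 1) + 𝟙 (adj T c c)
      ≡⟨ sum-update (𝟙 ∘ adj T c) (λ _ → 1) c (λ y y≢c → cong 𝟙 (c-adj y≢c)) ⟨
    count (adj T c) + 1                  ≡⟨ cong (_+ 1) (trans (sym (valence≡count T c)) (ofValence⇒hub T (proj₂ hub))) ⟩
    n + 1                                ≡⟨ +-comm n 1 ⟩
    suc n                                ∎
    where open ≡-Reasoning

star-Bi : ∀ {n} → 2 ≤ n → Bi 1 n (star n)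
star-Bi {n} 2≤n = record
  { tree     = record
    { nonempty  = s≤s z≤n
    ; symmetric = symmetricˢ
    ; loopless  = λ { zero → refl ; (suc _) → refl }
    ; connected = λ w u → to-hub w ◅◅ from-hub u
    ; acyclic   = acyclic }
  ; valences = λ { zero → inj₂ valence-hub ; (suc k) → inj₁ (valence-leaf k) }
  ; count-n  = trans (countᵇ-allFin (ofValence S n))
      (cong₂ _+_ (cong 𝟙 (ofValence-hub S {zero} valence-hub))
                 (sum-zero (𝟙 ∘ ofValence S n ∘ suc)
                           (λ k → cong 𝟙 (ofValence-leaf S {suc k} 2≤n (valence-leaf k))))) }
  where
  S : Graph
  S = star n

  to-hub : ∀ w → Walk S w zero
  to-hub zero    = here
  to-hub (suc w) = step refl here

  from-hub : ∀ w → Walk S zero w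
  from-hub zero    = here
  from-hub (suc w) = step refl here

  leaf-pendant : ∀ k → AtMostOneNeighbour S (suc k)
  leaf-pendant k {zero} {zero} _ _ = refl

  symmetricˢ : ∀ w u → adj S w u ≡ adj S u w
  symmetricˢ zero    zero    = refl
  symmetricˢ zero    (suc u) = refl
  symmetricˢ (suc w) zero    = refl
  symmetricˢ (suc w) (suc u) = refl

  acyclic : ∀ j c → ¬ IsCycle S j c
  acyclic j c cyc@(c-inj , _) = by-first-two (c zero) (c (suc zero)) refl refl
    where
    leaf-on-cycle : ∀ t k → c t ≡ suc k → ⊥
    leaf-on-cycle t k ct≡k = cycle-avoids-pendant S j c symmetricˢ cyc t
      (subst (AtMostOneNeighbour S) (sym ct≡k) (leaf-pendant k))
    by-first-two : ∀ a b → c zero ≡ a → c (suc zero) ≡ b → ⊥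
    by-first-two (suc k) _       c₀ _  = leaf-on-cycle zero k c₀
    by-first-two zero    (suc k) _  c₁ = leaf-on-cycle (suc zero) k c₁
    by-first-two zero    zero    c₀ c₁ with c-inj zero (suc zero) (trans c₀ (sym c₁))
    ... | ()

  valence-hub : valence S zero ≡ n
  valence-hub = trans (valence≡count S zero) (sum-one n)

  valence-leaf : ∀ k → valence S (suc k) ≡ 1
  valence-leaf k = trans (valence≡count S (suc k)) (cong suc (sum-zero {n} _ (λ _ → refl)))

-- Leaves of the tree spanned by the internal vertices

IsPath : (G : Graph) (k : ℕ) → (Fin (suc k) → Fin (size G)) → Set
IsPath G k p = (∀ a b → p a ≡ p b → a ≡ b) × (∀ (i : Fin k) → adj G (p (inject₁ i)) (p (suc i)) ≡ true)

-- Closing p 0, …, p (2 + i) by the edge back to p 0 would give a cycle of length 3 + i.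
path-start-adj : ∀ {T k} {p : Fin (2 + k) → Fin (size T)} → IsTree T → IsPath T (suc k) p →
  ∀ i → adj T (p zero) (p i) ≡ true → i ≡ suc zero
path-start-adj tree _ zero e = contradiction (trans (sym e) (IsTree.loopless tree _)) (λ ())
path-start-adj tree _ (suc zero) _ = refl
path-start-adj {T} {k} {p} tree (p-inj , path) (suc (suc i)) e =
  contradiction (c-inj , c-path , c-close) (IsTree.acyclic tree (toℕ i) c)
  where
  j : ℕ
  j = toℕ i
  3+j≤2+k : 3 + j ≤ 2 + k
  3+j≤2+k = s≤s (s≤s (toℕ<n i))
  2+j≤1+k : 2 + j ≤ suc k
  2+j≤1+k = s≤s⁻¹ 3+j≤2+k
  c : Fin (3 + j) → Fin (size T)
  c t = p (inject≤ t 3+j≤2+k)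
  c-inj : ∀ a b → c a ≡ c b → a ≡ b
  c-inj a b ca≡cb = inject≤-injective 3+j≤2+k 3+j≤2+k a b (p-inj _ _ ca≡cb)
  c-path : ∀ (t : Fin (2 + j)) → adj T (c (inject₁ t)) (c (suc t)) ≡ true
  c-path t = trans (cong₂ (λ a b → adj T (p a) (p b)) inject-inject₁ refl) (path (inject≤ t 2+j≤1+k))
    where
    inject-inject₁ : inject≤ (inject₁ t) 3+j≤2+k ≡ inject₁ (inject≤ t 2+j≤1+k)
    inject-inject₁ = toℕ-injective (trans (toℕ-inject≤ (inject₁ t) 3+j≤2+k)
      (trans (toℕ-inject₁ t) (sym (trans (toℕ-inject₁ (inject≤ t 2+j≤1+k)) (toℕ-inject≤ t 2+j≤1+k)))))
  c-close : adj T (c (fromℕ (2 + j))) (c zero) ≡ true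
  c-close = trans (cong (λ a → adj T (p a) (p zero)) inject-last) (trans (IsTree.symmetric tree _ _) e)
    where
    inject-last : inject≤ (fromℕ (2 + j)) 3+j≤2+k ≡ suc (suc i)
    inject-last = toℕ-injective (trans (toℕ-inject≤ (fromℕ (2 + j)) 3+j≤2+k) (toℕ-fromℕ (2 + j)))

InducedLeaf : (G : Graph) → (Fin (size G) → Set) → Fin (size G) → Fin (size G) → Set
InducedLeaf G I u w = I u × I w × adj G u w ≡ true × (∀ {y} → adj G u y ≡ true → I y → y ≡ w)

module _ {T : Graph} (tree : IsTree T) {I : Fin (size T) → Set} (I? : ∀ x → Dec (I x)) where
  open IsTree tree

  -- Extend the path at its start through I for as long as possible; a path has at most
  -- size T vertices, so the fuel bounds the number of extensions.
  induced-leaf-from-path : ∀ fuel k (p : Fin (2 + k) → Fin (size T)) → IsPath T (suc k) p →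
    I (p zero) → I (p (suc zero)) → size T ≤ fuel + (2 + k) → ∃₂ (InducedLeaf T I)
  induced-leaf-from-path fuel k p p-path I₀ I₁ bound
    with any? (λ y → (adj T (p zero) y Bool≟ true) ×-dec I? y ×-dec ¬? (y ≟ p (suc zero)))
  ... | no none = p zero , p (suc zero) , I₀ , I₁ , proj₂ p-path zero , only-p₁
    where
    only-p₁ : ∀ {y} → adj T (p zero) y ≡ true → I y → y ≡ p (suc zero)
    only-p₁ {y} p₀-y I-y with y ≟ p (suc zero)
    ... | yes y≡p₁ = y≡p₁
    ... | no y≢p₁  = contradiction (y , p₀-y , I-y , y≢p₁) none
  ... | yes (y , p₀-y , I-y , y≢p₁) = prepend fuel bound
    where
    y-fresh : ∀ i → p i ≢ y
    y-fresh i refl = y≢p₁ (cong p (path-start-adj tree p-path i p₀-y))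
    p′ : Fin (3 + k) → Fin (size T)
    p′ = y ∷ p
    p′-inj : ∀ a b → p′ a ≡ p′ b → a ≡ b
    p′-inj zero    zero    _  = refl
    p′-inj zero    (suc b) eq = contradiction (sym eq) (y-fresh b)
    p′-inj (suc a) zero    eq = contradiction eq (y-fresh a)
    p′-inj (suc a) (suc b) eq = cong suc (proj₁ p-path a b eq)
    p′-path : IsPath T (2 + k) p′
    p′-path = p′-inj , λ { zero → trans (symmetric y (p zero)) p₀-y ; (suc i) → proj₂ p-path i }
    prepend : ∀ fuel → size T ≤ fuel + (2 + k) → ∃₂ (InducedLeaf T I)
    prepend zero    bound = contradiction (≤-trans (injective⇒≤ (λ {a} {b} → p′-inj a b)) bound) (1+n≰n {2 + k})
    prepend (suc fuel) bound =
      induced-leaf-from-path fuel (suc k) p′ p′-path I-y I₀ (≤-trans bound (≤-reflexive (sym (+-suc fuel (2 + k)))))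

  induced-leaf : ∀ {x y} → I x → I y → adj T x y ≡ true → ∃₂ (InducedLeaf T I)
  induced-leaf {x} {y} I-x I-y x-y =
    induced-leaf-from-path (size T) 0 (x ∷ y ∷ []) (xy-inj , λ { zero → x-y }) I-x I-y (m≤m+n (size T) 2)
    where
    x≢y : x ≢ y
    x≢y refl = contradiction (trans (sym x-y) (loopless x)) (λ ())
    xy-inj : ∀ a b → (x ∷ y ∷ []) a ≡ (x ∷ y ∷ []) b → a ≡ b
    xy-inj zero       zero       _  = refl
    xy-inj zero       (suc zero) eq = contradiction eq x≢y
    xy-inj (suc zero) zero       eq = contradiction (sym eq) x≢y
    xy-inj (suc zero) (suc zero) _  = refl

hub-induced-leaf : ∀ {m n T} → Bi m n T → 2 ≤ m → ∃₂ (InducedLeaf T (IsHub n T))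
hub-induced-leaf {n = n} {T} B 2≤m with count-two (ofValence T n) (≤-trans 2≤m (≤-reflexive (sym (Bi-count B))))
... | x , x′ , x≢x′ , hub-x , hub-x′
  with neighbour-in (Bi.tree B) (hub? T) (non-hub-leaf B) x≢x′ (ofValence⇒hub T hub-x′)
... | y , hub-y , x-y = induced-leaf (Bi.tree B) (hub? T) (ofValence⇒hub T hub-x) hub-y x-y

-- Removing the leaves at a leaf of the internal tree

record Partition {N} (P : Fin N → Bool) : Set where
  field
    A B     : ℕ
    to      : Fin N → Fin A ⊎ Fin B
    from    : Fin A ⊎ Fin B → Fin N
    to-from : ∀ s → to (from s) ≡ s
    from-to : ∀ x → from (to x) ≡ x
    P-inj₁  : ∀ a → P (from (inj₁ a)) ≡ false
    P-inj₂  : ∀ b → P (from (inj₂ b)) ≡ true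

  split : Fin N ↔ (Fin A ⊎ Fin B)
  split = mk↔ₛ′ to from to-from from-to

  from-injective : ∀ {s t} → from s ≡ from t → s ≡ t
  from-injective {s} {t} eq = trans (sym (to-from s)) (trans (cong to eq) (to-from t))

  sum-partition : ∀ (f : Fin N → ℕ) → sum f ≡ sum (f ∘ from ∘ inj₁) + sum (f ∘ from ∘ inj₂)
  sum-partition f = trans (sum-permute f (↔-sym split ↔-∘ +↔⊎))
    (trans (sum-↑ A (f ∘ from ∘ splitAt A))
           (cong₂ _+_ (sum-cong-≗ (λ a → cong (f ∘ from) (splitAt-↑ˡ A a B)))
                      (sum-cong-≗ (λ b → cong (f ∘ from) (splitAt-↑ʳ A B b)))))

partition : ∀ {N} (P : Fin N → Bool) → Partition P
partition {zero} P = record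
  { A = 0 ; B = 0 ; to = λ () ; from = λ { (inj₁ ()) ; (inj₂ ()) }
  ; to-from = λ { (inj₁ ()) ; (inj₂ ()) } ; from-to = λ () ; P-inj₁ = λ () ; P-inj₂ = λ () }
partition {suc N} P with P zero in P₀
... | false = record
  { A = suc A ; B = B ; to = to′ ; from = from′
  ; to-from = λ { (inj₁ zero)    → refl
                ; (inj₁ (suc a)) → cong (⊎-map suc id) (to-from (inj₁ a))
                ; (inj₂ b)       → cong (⊎-map suc id) (to-from (inj₂ b)) }
  ; from-to = λ { zero → refl ; (suc x) → trans (from′-suc (to x)) (cong suc (from-to x)) }
  ; P-inj₁ = λ { zero → P₀ ; (suc a) → P-inj₁ a } ; P-inj₂ = P-inj₂ }
  where
  open Partition (partition (P ∘ suc))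
  to′ : Fin (suc N) → Fin (suc A) ⊎ Fin B
  to′ zero    = inj₁ zero
  to′ (suc x) = ⊎-map suc id (to x)
  from′ : Fin (suc A) ⊎ Fin B → Fin (suc N)
  from′ (inj₁ zero)    = zero
  from′ (inj₁ (suc a)) = suc (from (inj₁ a))
  from′ (inj₂ b)       = suc (from (inj₂ b))
  from′-suc : ∀ s → from′ (⊎-map suc id s) ≡ suc (from s)
  from′-suc (inj₁ _) = refl
  from′-suc (inj₂ _) = refl
... | true = record
  { A = A ; B = suc B ; to = to′ ; from = from′
  ; to-from = λ { (inj₂ zero)    → refl
                ; (inj₂ (suc b)) → cong (⊎-map id suc) (to-from (inj₂ b))
                ; (inj₁ a)       → cong (⊎-map id suc) (to-from (inj₁ a)) }
  ; from-to = λ { zero → refl ; (suc x) → trans (from′-suc (to x)) (cong suc (from-to x)) }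
  ; P-inj₁ = P-inj₁ ; P-inj₂ = λ { zero → P₀ ; (suc b) → P-inj₂ b } }
  where
  open Partition (partition (P ∘ suc))
  to′ : Fin (suc N) → Fin A ⊎ Fin (suc B)
  to′ zero    = inj₂ zero
  to′ (suc x) = ⊎-map id suc (to x)
  from′ : Fin A ⊎ Fin (suc B) → Fin (suc N)
  from′ (inj₂ zero)    = zero
  from′ (inj₂ (suc b)) = suc (from (inj₂ b))
  from′ (inj₁ a)       = suc (from (inj₁ a))
  from′-suc : ∀ s → from′ (⊎-map id suc s) ≡ suc (from s)
  from′-suc (inj₁ _) = refl
  from′-suc (inj₂ _) = refl

module Prune {m n T} (2≤n : 2 ≤ n) (bi : Bi (suc m) n T) {u w} (hub-u : IsHub n T u) (hub-w : IsHub n T w)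
  (u-w : adj T u w ≡ true) (only-w : ∀ {y} → adj T u y ≡ true → IsHub n T y → y ≡ w) where
  open Bi bi
  open IsTree tree

  pendant : Fin (size T) → Bool
  pendant y = adj T u y ∧ ⌊ valence T y ℕ≟ 1 ⌋

  private module P = Partition (partition pendant)

  old : Fin P.A → Fin (size T)
  old a = P.from (inj₁ a)

  leaf : Fin P.B → Fin (size T)
  leaf b = P.from (inj₂ b)

  old-injective : ∀ {a b} → old a ≡ old b → a ≡ b
  old-injective = inj₁-injective ∘ P.from-injective

  u-leaf : ∀ b → adj T u (leaf b) ≡ true
  u-leaf b = ∧-conicalˡ _ _ (P.P-inj₂ b)

  leaf-valence : ∀ b → valence T (leaf b) ≡ 1
  leaf-valence b = ⌊⌋≡true⇒ (_ ℕ≟ 1) (∧-conicalʳ _ _ (P.P-inj₂ b))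

  leaf-only-u : ∀ b {y} → adj T (leaf b) y ≡ true → y ≡ u
  leaf-only-u b e = leaf-neighbour-unique T (leaf-valence b) e (trans (symmetric (leaf b) u) (u-leaf b))

  old-or-leaf : ∀ x → (∃ λ a → x ≡ old a) ⊎ (∃ λ b → x ≡ leaf b)
  old-or-leaf x with P.to x in eq
  ... | inj₁ a = inj₁ (a , trans (sym (P.from-to x)) (cong P.from eq))
  ... | inj₂ b = inj₂ (b , trans (sym (P.from-to x)) (cong P.from eq))

  old-of : ∀ {x} → pendant x ≡ false → ∃ λ a → x ≡ old a
  old-of {x} not-pendant with old-or-leaf x
  ... | inj₁ x-old       = x-old
  ... | inj₂ (b , refl)  = contradiction (trans (sym not-pendant) (P.P-inj₂ b)) (λ ())

  pendant-u : pendant u ≡ false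
  pendant-u = cong (_∧ ⌊ valence T u ℕ≟ 1 ⌋) (loopless u)

  u-old : ∃ λ a → u ≡ old a
  u-old = old-of pendant-u

  w-old : ∃ λ a → w ≡ old a
  w-old = old-of (trans (cong (adj T u w ∧_) w-not-leaf) (∧-zeroʳ (adj T u w)))
    where
    w-not-leaf : ⌊ valence T w ℕ≟ 1 ⌋ ≡ false
    w-not-leaf = ⌊⌋-false (valence T w ℕ≟ 1) (λ w-leaf → <⇒≢ 2≤n (trans (sym w-leaf) hub-w))

  u′ w′ : Fin P.A
  u′ = proj₁ u-old
  w′ = proj₁ w-old

  T₀ : Graph
  T₀ = mkGraph P.A (λ a b → adj T (old a) (old b))

  u≡old-u′ : u ≡ old u′
  u≡old-u′ = proj₂ u-old

  adj-u′ : ∀ a → adj T₀ u′ a ≡ adj T u (old a)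
  adj-u′ a = cong (λ z → adj T z (old a)) (sym u≡old-u′)

  old-neighbour-of-u-hub : ∀ {a} → adj T u (old a) ≡ true → IsHub n T (old a)
  old-neighbour-of-u-hub {a} e with hub? T (old a)
  ... | yes hub = hub
  ... | no ¬hub = contradiction (trans (sym (P.P-inj₁ a)) pendant-old-a) (λ ())
    where
    pendant-old-a : pendant (old a) ≡ true
    pendant-old-a = cong₂ _∧_ e (⌊⌋-true (_ ℕ≟ 1) (non-hub-leaf bi (old a) ¬hub))

  old-leaf-adj : ∀ {a} b → adj T (old a) (leaf b) ≡ true → a ≡ u′
  old-leaf-adj b e = old-injective (trans (leaf-only-u b (trans (symmetric _ _) e)) u≡old-u′)

  old-u′-leaf : ∀ b → adj T (old u′) (leaf b) ≡ true
  old-u′-leaf b = subst (λ z → adj T z (leaf b) ≡ true) u≡old-u′ (u-leaf b)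

  valence-u′ : valence T₀ u′ ≡ 1
  valence-u′ = trans (valence≡count T₀ u′) (count-single (adj T₀ u′) w′ u′-w′ others)
    where
    u′-w′ : adj T₀ u′ w′ ≡ true
    u′-w′ = trans (adj-u′ w′) (trans (cong (adj T u) (sym (proj₂ w-old))) u-w)
    others : ∀ a → a ≢ w′ → adj T₀ u′ a ≡ false
    others a a≢w′ = trans (adj-u′ a) (¬-not λ e →
      a≢w′ (old-injective (trans (only-w e (old-neighbour-of-u-hub e)) (proj₂ w-old))))

  valence-old : ∀ a → valence T (old a) ≡ valence T₀ a + count (adj T (old a) ∘ leaf)
  valence-old a = trans (valence≡count T (old a)) (trans (P.sum-partition (𝟙 ∘ adj T (old a)))
    (cong (_+ count (adj T (old a) ∘ leaf)) (sym (valence≡count T₀ a))))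

  valence-old-≢ : ∀ {a} → a ≢ u′ → valence T₀ a ≡ valence T (old a)
  valence-old-≢ {a} a≢u′ = sym (trans (valence-old a) (trans (cong (valence T₀ a +_)
    (sum-zero (𝟙 ∘ adj T (old a) ∘ leaf) (λ b → cong 𝟙 (¬-not λ e → a≢u′ (old-leaf-adj b e))))) (+-identityʳ _)))

  #leaves : P.B ≡ n ∸ 1
  #leaves = cong (_∸ 1) (sym (begin
    n                                        ≡⟨ hub-u ⟨
    valence T u                              ≡⟨ cong (valence T) u≡old-u′ ⟩
    valence T (old u′)                       ≡⟨ valence-old u′ ⟩
    valence T₀ u′ + count (adj T (old u′) ∘ leaf)
      ≡⟨ cong₂ _+_ valence-u′ (trans (sum-cong-≗ (cong 𝟙 ∘ old-u′-leaf)) (sum-one P.B)) ⟩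
    suc P.B                                  ∎))
    where open ≡-Reasoning

  T≅Ext : T ≅ Ext n T₀ u′
  T≅Ext = ≅-Ext n T₀ u′ ((↔-refl ⊎-↔ leaves↔) ↔-∘ P.split)
    (λ x y → trans (adj-parts (P.to x) (P.to y)) (cong₂ (adj T) (P.from-to x) (P.from-to y)))
    where
    -- Ext-adj does not look at which new vertex is meant, so any bijection of the leaves will do.
    leaves↔ : Fin P.B ↔ Fin (n ∸ 1)
    leaves↔ = subst (λ k → Fin P.B ↔ Fin k) #leaves ↔-refl
    old-leaf : ∀ a b → ⌊ a ≟ u′ ⌋ ≡ adj T (old a) (leaf b)
    old-leaf a b with a ≟ u′
    ... | yes refl = sym (old-u′-leaf b)
    ... | no a≢u′  = sym (¬-not λ e → a≢u′ (old-leaf-adj b e))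
    parts : Fin P.A ⊎ Fin P.B → Fin P.A ⊎ Fin (n ∸ 1)
    parts = ⊎-map id (Inverse.to leaves↔)
    adj-parts : ∀ s t → Ext-adj n T₀ u′ (parts s) (parts t) ≡ adj T (P.from s) (P.from t)
    adj-parts (inj₁ a) (inj₁ b)  = refl
    adj-parts (inj₁ a) (inj₂ b)  = old-leaf a b
    adj-parts (inj₂ b) (inj₁ a)  = trans (old-leaf a b) (symmetric (old a) (leaf b))
    adj-parts (inj₂ b) (inj₂ b′) = sym (¬-not λ e →
      contradiction (trans (sym (P.P-inj₂ b′)) (trans (cong pendant (leaf-only-u b e)) pendant-u)) (λ ()))

  -- A detour old a – leaf d – z′ returns with z′ = old a, as the leaf has only one neighbour.
  restrict : ∀ {a y} → Walk T (old a) y → ∀ {b} → y ≡ old b → Walk T₀ a b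
  restrict {a} here y≡old = subst (Walk T₀ a) (old-injective y≡old) here
  restrict (step {v = z} e w) y≡old with old-or-leaf z
  ... | inj₁ (c , refl) = step e (restrict w y≡old)
  ... | inj₂ (d , refl) with w
  ...   | here = contradiction (P.from-injective y≡old) (λ ())
  ...   | step e′ w′ with leaf-neighbour-unique T (leaf-valence d) e′ (trans (symmetric _ _) e)
  ...     | refl = restrict w′ y≡old

  T₀-isTree : IsTree T₀
  T₀-isTree = record
    { nonempty  = ≤-trans (s≤s z≤n) (toℕ<n u′)
    ; symmetric = λ a b → symmetric (old a) (old b)
    ; loopless  = λ a → loopless (old a)
    ; connected = λ a b → restrict (connected (old a) (old b)) refl
    ; acyclic   = λ j c (c-inj , path , close) →
        acyclic j (old ∘ c) ((λ s t eq → c-inj s t (old-injective eq)) , path , close) }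

  count-old : count (ofValence T n ∘ old) ≡ suc m
  count-old = begin
    count (ofValence T n ∘ old)                                    ≡⟨ +-identityʳ _ ⟨
    count (ofValence T n ∘ old) + 0
      ≡⟨ cong (count (ofValence T n ∘ old) +_) count-leaf ⟨
    count (ofValence T n ∘ old) + count (ofValence T n ∘ leaf)     ≡⟨ P.sum-partition (𝟙 ∘ ofValence T n) ⟨
    count (ofValence T n)                                          ≡⟨ Bi-count bi ⟩
    suc m                                                          ∎
    where
    open ≡-Reasoning
    count-leaf : count (ofValence T n ∘ leaf) ≡ 0
    count-leaf = sum-zero (𝟙 ∘ ofValence T n ∘ leaf) (λ b → cong 𝟙 (ofValence-leaf T 2≤n (leaf-valence b)))

  -- Only u loses its hub status: u′ is a leaf of T₀.
  count₀ : count (ofValence T₀ n) ≡ m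
  count₀ = suc-injective (begin
    suc (count (ofValence T₀ n))                            ≡⟨ +-comm 1 (count (ofValence T₀ n)) ⟩
    count (ofValence T₀ n) + 1
      ≡⟨ cong (λ b → count (ofValence T₀ n) + 𝟙 b) hub-old-u′ ⟨
    count (ofValence T₀ n) + 𝟙 (ofValence T n (old u′))
      ≡⟨ sum-update (𝟙 ∘ ofValence T₀ n) (𝟙 ∘ ofValence T n ∘ old) u′ (λ _ a≢u′ → cong 𝟙 (ofValence-cong T₀ T (valence-old-≢ a≢u′))) ⟩
    count (ofValence T n ∘ old) + 𝟙 (ofValence T₀ n u′)
      ≡⟨ cong₂ (λ c b → c + 𝟙 b) count-old (ofValence-leaf T₀ 2≤n valence-u′) ⟩
    suc m + 0                                               ≡⟨ +-identityʳ (suc m) ⟩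
    suc m                                                   ∎)
    where
    open ≡-Reasoning
    hub-old-u′ : ofValence T n (old u′) ≡ true
    hub-old-u′ = ofValence-hub T (trans (cong (valence T) (sym u≡old-u′)) hub-u)

  T₀-Bi : Bi m n T₀
  T₀-Bi = record
    { tree     = T₀-isTree
    ; valences = valences₀
    ; count-n  = trans (countᵇ-allFin (ofValence T₀ n)) count₀ }
    where
    valences₀ : ∀ a → valence T₀ a ≡ 1 ⊎ valence T₀ a ≡ n
    valences₀ a with a ≟ u′
    ... | yes refl = inj₁ valence-u′
    ... | no a≢u′ rewrite valence-old-≢ a≢u′ = valences (old a)

Bi-prune : ∀ {m n T} → 2 ≤ n → Bi (suc (suc m)) n T →
  Σ Graph λ T₀ → Σ (Fin (size T₀)) λ v → Bi (suc m) n T₀ × IsExternal T₀ v × T ≅ Ext n T₀ v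
Bi-prune 2≤n bi with hub-induced-leaf bi (s≤s (s≤s z≤n))
... | _ , _ , hub-u , hub-w , u-w , only-w = T₀ , u′ , T₀-Bi , valence-u′ , T≅Ext
  where open Prune 2≤n bi hub-u hub-w u-w only-w


theorem3p15 : (n m : ℕ) → 2 ≤ n → 2 ≤ m →
    (s : ℕ) (S : Fin s → Graph) →
    (∀ i → Bi (m ∸ 1) n (S i)) →
    (∀ T → Bi (m ∸ 1) n T → Σ (Fin s) λ i → T ≅ S i) →
    (∀ i j → S i ≅ S j → i ≡ j) →
    (R : (i : Fin s) → List (Fin (size (S i)))) →
    (∀ i v → v ∈ R i → IsExternal (S i) v) →
    (∀ i v → IsExternal (S i) v → Σ (Fin (size (S i))) λ w → w ∈ R i × ExtEquiv (S i) v w) →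
    (∀ i v w → v ∈ R i → w ∈ R i → ExtEquiv (S i) v w → v ≡ w) →
    ((∀ T → Bi m n T → Σ (Fin s) λ i → Σ (Fin (size (S i))) λ v → v ∈ R i × (T ≅ Ext n (S i) v)) ×
     (∀ i v → v ∈ R i → Bi m n (Ext n (S i) v)) ×
     (Bi 1 n (star n) × (∀ T → Bi 1 n T → T ≅ star n)))
theorem3p15 _ 1 _ (s≤s ())
theorem3p15 n (suc (suc m)) 2≤n _ s S S-Bi S-complete _ R R-external R-complete _ =
  representative
  , (λ i v v∈R → Ext-Bi v 2≤n (S-Bi i) (R-external i v v∈R))
  , star-Bi 2≤n
  , λ _ → Bi1-≅-star 2≤n
  where
  representative : ∀ T → Bi (suc (suc m)) n T →
    Σ (Fin s) λ i → Σ (Fin (size (S i))) λ v → v ∈ R i × (T ≅ Ext n (S i) v)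
  representative T bi =
    let T₀ , v , T₀-Bi , v-external , T≅Ext = Bi-prune 2≤n bi
        i , τ = S-complete T₀ T₀-Bi
        r , r∈R , σ , _ , στv≡r = R-complete i (isoMap τ v) (trans (valence-isoMap τ v) v-external)
    in i , r , r∈R , ≅-trans T≅Ext (Ext-cong n (≅-trans τ σ) στv≡r)
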